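{- Let $G$ be a necklace. If $G$ is not a cycle, then $G$ is of class $1^\pm$.
   Context: A necklace is a finite simple connected graph whose edge set can be decomposed into $k\geq2$ paths (each with at least one edge) all of which start at a common vertex $u$ and end at a common vertex $v\neq u$, such that apart from $u$ and $v$ all vertices of these paths are pairwise distinct (i.e. the paths are internally vertex-disjoint $u$–$v$ paths). A signed graph is a pair $(G,\sigma)$ with $\sigma\colon E(G)\to\{\pm1\}$ a signature. An incidence is a pair $v\colon e$ with $v$ an endpoint of edge $e$; $I(G)$ is the set of incidences. For a positive integer $n$ let $M_n=\{0,\pm1,\dots,\pm k\}$ if $n=2k+1$ and $M_n=\{\pm1,\dots,\pm k\}$ if $n=2k$. An $n$-edge-coloring of $(G,\sigma)$ is a map $f\colon I(G)\to M_n$ with $f(u\colon uv)=-\sigma(uv)f(v\colon uv)$ for every edge $uv$, and $f(u\colon e_1)\neq f(u\colon e_2)$ whenever $e_1\neq e_2$ are both incident to $u$. The chromatic index $\chi'(G,\sigma)$ is the least positive integer $n$ for which an $n$-edge-coloring exists. A graph $G$ is of class $1^\pm$ if $\chi'(G,\sigma)=\Delta(G)$ for every signature $\sigma$ of $G$, where $\Delta(G)$ is the maximum degree. -}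

module Defs where

open import Data.Nat as ℕ using (ℕ; zero; suc; _≤_; _<_; _/_; _%_; _⊔_)
open import Data.Nat.Properties using ()
open import Data.Integer as ℤ using (ℤ; ∣_∣; -_; 0ℤ)
open import Data.Sign using (Sign) renaming (+ to ⊕; - to ⊖)
open import Data.Fin using (Fin; toℕ)
open import Data.Bool using (Bool; true; false; T; if_then_else_)
open import Data.List using (List; []; _∷_; _++_; allFin; map; foldr)
open import Data.Nat.ListAction using (sum)
open import Data.List.Relation.Unary.Linked using (Linked)
open import Data.List.Relation.Unary.Unique.Propositional using (Unique)
open import Data.List.Membership.Propositional using (_∈_)
open import Data.Product using (Σ; ∃; _×_; _,_)
open import Data.Sum using (_⊎_)
open import Data.Empty using (⊥)
open import Relation.Nullary using (¬_)
open import Relation.Binary.PropositionalEquality using (_≡_; _≢_)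
open import Relation.Binary.Construct.Closure.ReflexiveTransitive using (Star)


record Graph (n : ℕ) : Set where
  field
    adj    : Fin n → Fin n → Bool
    sym    : ∀ u v → adj u v ≡ adj v u
    irrefl : ∀ u → adj u u ≡ false
open Graph public

module _ {n : ℕ} (G : Graph n) where

  Adj : Fin n → Fin n → Set
  Adj u v = T (adj G u v)

  degree : Fin n → ℕ
  degree u = sum (map (λ v → if adj G u v then 1 else 0) (allFin n))

  Δ : ℕ
  Δ = foldr _⊔_ 0 (map degree (allFin n))

  Connected : Set
  Connected = ∀ a b → Star Adj a b

  -- G is a cycle: n ≥ 3 and there is a bijective labelling π of the
  -- vertices by Z_n such that π i, π j are adjacent iff j = i ± 1 (mod n)
  -- j ≡ i + 1 (mod n)
  CycSucc : Fin n → Fin n → Set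
  CycSucc i j = suc (toℕ i) ≡ toℕ j ⊎ (suc (toℕ i) ≡ n × toℕ j ≡ 0)

  IsCycle : Set
  IsCycle = 3 ≤ n × Σ (Fin n → Fin n) λ π →
              (∀ i j → π i ≡ π j → i ≡ j) ×
              (∀ i j → Adj (π i) (π j) →
                   (CycSucc i j ⊎ CycSucc j i)) ×
              (∀ i j → (CycSucc i j ⊎ CycSucc j i) →
                   Adj (π i) (π j))

data Consec {A : Set} (a b : A) : List A → Set where
  here  : ∀ {xs} → Consec a b (a ∷ b ∷ xs)
  there : ∀ {x xs} → Consec a b xs → Consec a b (x ∷ xs)

EdgeOf : {A : Set} → A → A → List A → Set
EdgeOf a b xs = Consec a b xs ⊎ Consec b a xs

module _ {n : ℕ} (G : Graph n) where

  path : Fin n → Fin n → List (Fin n) → List (Fin n)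
  path u v mid = u ∷ mid ++ v ∷ []

  IsPath : Fin n → Fin n → List (Fin n) → Set
  IsPath u v mid = Linked (Adj G) (path u v mid) × Unique (path u v mid)

  IsNecklace : Set
  IsNecklace =
    Connected G ×
    Σ (Fin n) λ u → Σ (Fin n) λ v → Σ ℕ λ k → Σ (Fin k → List (Fin n)) λ mid →
      u ≢ v × 2 ≤ k ×
      (∀ i → IsPath u v (mid i)) ×
      (∀ i j x → x ∈ mid i → x ∈ mid j → i ≡ j) ×
      (∀ a b → Adj G a b → Σ (Fin k) λ i → EdgeOf a b (path u v (mid i))) ×
      (∀ a b i j → EdgeOf a b (path u v (mid i)) → EdgeOf a b (path u v (mid j)) → i ≡ j)

-- M_n = {0,±1,…,±k} for n = 2k+1 and {±1,…,±k} for n = 2k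
InM : ℕ → ℤ → Set
InM m z = ∣ z ∣ ≤ m / 2 × (m % 2 ≡ 0 → z ≢ 0ℤ)

signℤ : Sign → ℤ
signℤ ⊕ = ℤ.+ 1
signℤ ⊖ = ℤ.- (ℤ.+ 1)

module _ {n : ℕ} (G : Graph n) where

  -- a signature: a sign for each edge (values on non-edges are irrelevant)
  Signature : Set
  Signature = Σ (Fin n → Fin n → Sign) λ σ → ∀ u v → Adj G u v → σ u v ≡ σ v u

  -- an m-edge-colouring of (G,σ); f u v is the colour of the incidence u:uv
  EdgeColoring : Signature → ℕ → Set
  EdgeColoring (σ , _) m = Σ (Fin n → Fin n → ℤ) λ f →
    (∀ u v → Adj G u v → InM m (f u v)) ×
    (∀ u v → Adj G u v → f u v ≡ - (signℤ (σ u v) ℤ.* f v u)) ×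
    (∀ u v w → Adj G u v → Adj G u w → v ≢ w → f u v ≢ f u w)

  ChromaticIndexIs : Signature → ℕ → Set
  ChromaticIndexIs σ c =
    1 ≤ c × EdgeColoring σ c × (∀ m → 1 ≤ m → m < c → ¬ EdgeColoring σ m)

  Class1± : Set
  Class1± = ∀ (σ : Signature) → ChromaticIndexIs σ (Δ G)

module Submission where

-- The vertex u has degree k, v has degree at most k and every other
-- vertex degree at most 2, so Δ = k, and the k edges at u already need k colours. For k = 2 the
-- necklace is a cycle, so k ≥ 3. Switching along a path makes all its edges positive, and then a
-- colouring of the path is a sequence of colours γ₀, …, γₗ₋₁ with γⱼ₊₁ ≢ -γⱼ whose interior can be
-- filled with ±1; so only the colours at u and at v matter, one condition per path (Compatible).
-- These end colours are found by induction on k in steps of 2: two paths that are not single edges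
-- and have the same sign product take the two colours ±⌊k/2⌋ of M_k missing from M_(k-2), and among
-- any four paths there are two such. The base cases k = 3, 4 are settled by exhaustive search.

open import Data.Bool as Bool using (Bool; true; false; T; if_then_else_)
open import Data.Empty using (⊥-elim; ⊥)
open import Data.Fin as Fin using (Fin; toℕ)
import Data.Fin.Properties as FinP
open import Data.Integer as ℤ using (ℤ; ∣_∣; -_; 0ℤ; +_; -[1+_])
import Data.Integer.Properties as ℤP
open import Data.List using (List; []; _∷_; _++_; length; map; concatMap; filter; foldr; lookup; zip; allFin)
open import Data.List.Membership.Propositional using (_∈_)
open import Data.List.Membership.Propositional.Properties
  using (∈-filter⁺; ∈-filter⁻; ∈-allFin; ∈-lookup; ∈-map⁺; ∈-concatMap⁺)
import Data.List.Properties as ListP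
open import Data.List.Relation.Binary.Permutation.Propositional
  using (_↭_; ↭-refl; ↭-prep; ↭-swap; ↭-trans; ↭-sym; ↭⇒↭ₛ)
open import Data.List.Relation.Binary.Permutation.Propositional.Properties using (shift; ∈-resp-↭; ↭-length)
import Data.List.Relation.Binary.Permutation.Setoid.Properties as PermutationₛP
open import Data.List.Relation.Binary.Pointwise using (Pointwise; []; _∷_)
import Data.List.Relation.Binary.Pointwise.Properties as PointwiseP
open import Data.List.Relation.Unary.All as All using (All; []; _∷_; all?)
import Data.List.Relation.Unary.All.Properties as AllP
open import Data.List.Relation.Unary.AllPairs using ([]; _∷_; AllPairs; allPairs?)
open import Data.List.Relation.Unary.Any as Any using (here; there; Any; any?)
import Data.List.Relation.Unary.Any.Properties as AnyP
open import Data.List.Relation.Unary.Linked using (Linked; [-]; _∷_)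
import Data.List.Relation.Unary.Unique.DecPropositional as UniqueDec
open import Data.List.Relation.Unary.Unique.Propositional using (Unique)
import Data.List.Relation.Unary.Unique.Propositional.Properties as UniqueP
open import Data.Nat as ℕ using (ℕ; zero; suc; _≤_; _<_; _/_; _⊔_; z≤n; s≤s; _+_; _∸_; _%_)
open import Data.Nat.DivMod using (m/n≡1+[m∸n]/n)
open import Data.Nat.ListAction using (sum)
import Data.Nat.Properties as ℕP
open import Data.Product using (Σ; _×_; _,_; proj₁; proj₂; map₁)
open import Data.Sign as Sign using (Sign) renaming (+ to ⊕; - to ⊖)
import Data.Sign.Properties as SignP
open import Data.Sum using (_⊎_; inj₁; inj₂; swap)
open import Data.Unit using (tt)
open import Function using (_∘_; id)
open import Relation.Binary.Construct.Closure.ReflexiveTransitive using (ε; _◅_)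
open import Relation.Binary.PropositionalEquality as ≡
  using (_≡_; _≢_; refl; sym; trans; cong; cong₂; subst; subst₂; module ≡-Reasoning)
open import Relation.Nullary using (yes; no; ¬_; Dec)
open import Relation.Nullary.Decidable using (T?; toWitness; _×-dec_; _→-dec_; ¬?)

open import Defs hiding (sym)

-- Signs and the colour sets M_m

signℤ-homo-* : ∀ s t → signℤ (s Sign.* t) ≡ signℤ s ℤ.* signℤ t
signℤ-homo-* ⊕ ⊕ = refl
signℤ-homo-* ⊕ ⊖ = refl
signℤ-homo-* ⊖ ⊕ = refl
signℤ-homo-* ⊖ ⊖ = refl

signℤ-*-involutive : ∀ s x → signℤ s ℤ.* (signℤ s ℤ.* x) ≡ x
signℤ-*-involutive ⊕ x = trans (ℤP.*-identityˡ _) (ℤP.*-identityˡ x)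
signℤ-*-involutive ⊖ x = trans (ℤP.-1*i≡-i _) (trans (cong -_ (ℤP.-1*i≡-i x)) (ℤP.neg-involutive x))

neg-signℤ-*-involutive : ∀ s x → - (signℤ s ℤ.* - (signℤ s ℤ.* x)) ≡ x
neg-signℤ-*-involutive s x =
  trans (ℤP.neg-distribʳ-* (signℤ s) _)
        (trans (cong (signℤ s ℤ.*_) (ℤP.neg-involutive _)) (signℤ-*-involutive s x))

signℤ-*-cancel : ∀ s {x y} → signℤ s ℤ.* x ≡ signℤ s ℤ.* y → x ≡ y
signℤ-*-cancel s {x} {y} e =
  trans (sym (signℤ-*-involutive s x)) (trans (cong (signℤ s ℤ.*_) e) (signℤ-*-involutive s y))

∣signℤ-*∣ : ∀ s z → ∣ signℤ s ℤ.* z ∣ ≡ ∣ z ∣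
∣signℤ-*∣ ⊕ z = cong ∣_∣ (ℤP.*-identityˡ z)
∣signℤ-*∣ ⊖ z = trans (cong ∣_∣ (ℤP.-1*i≡-i z)) (ℤP.∣-i∣≡∣i∣ z)

∣-signℤ-*∣ : ∀ s z → ∣ - (signℤ s ℤ.* z) ∣ ≡ ∣ z ∣
∣-signℤ-*∣ s z = trans (ℤP.∣-i∣≡∣i∣ (signℤ s ℤ.* z)) (∣signℤ-*∣ s z)

-i≡i⇒i≡0 : ∀ i → - i ≡ i → i ≡ 0ℤ
-i≡i⇒i≡0 (+ zero) _ = refl

-signℤ-*≢signℤ-* : ∀ s {c} → c ≢ 0ℤ → - (signℤ s ℤ.* c) ≢ signℤ s ℤ.* c
-signℤ-*≢signℤ-* s {c} c≢0 e =
  c≢0 (ℤP.∣i∣≡0⇒i≡0 (trans (sym (∣signℤ-*∣ s c)) (cong ∣_∣ (-i≡i⇒i≡0 _ e))))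

sign-pigeonhole : ∀ (x y z : Sign) → x ≢ y → x ≢ z → y ≡ z
sign-pigeonhole ⊕ ⊕ _ x≢y _ = ⊥-elim (x≢y refl)
sign-pigeonhole ⊖ ⊖ _ x≢y _ = ⊥-elim (x≢y refl)
sign-pigeonhole ⊕ ⊖ ⊕ _ x≢z = ⊥-elim (x≢z refl)
sign-pigeonhole ⊖ ⊕ ⊖ _ x≢z = ⊥-elim (x≢z refl)
sign-pigeonhole ⊕ ⊖ ⊖ _ _ = refl
sign-pigeonhole ⊖ ⊕ ⊕ _ _ = refl

2+m/2≡1+m/2 : ∀ m → suc (suc m) / 2 ≡ suc (m / 2)
2+m/2≡1+m/2 m = m/n≡1+[m∸n]/n {suc (suc m)} {2} (s≤s (s≤s z≤n))

∣i∣≢0⇒i≢0 : ∀ {i} → ∣ i ∣ ≢ 0 → i ≢ 0ℤ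
∣i∣≢0⇒i≢0 ∣i∣≢0 refl = ∣i∣≢0 refl

InM-resp-∣∣ : ∀ {m z w} → ∣ w ∣ ≡ ∣ z ∣ → InM m z → InM m w
InM-resp-∣∣ {m} e (∣z∣≤ , z≢0) =
  subst (_≤ m / 2) (sym e) ∣z∣≤ , λ even w≡0 → z≢0 even (ℤP.∣i∣≡0⇒i≡0 (trans (sym e) (cong ∣_∣ w≡0)))

InM-2+ : ∀ {m z} → InM m z → InM (suc (suc m)) z
InM-2+ {m} {z} (∣z∣≤ , z≢0) = subst (∣ z ∣ ≤_) (sym (2+m/2≡1+m/2 m)) (ℕP.m≤n⇒m≤1+n ∣z∣≤) , z≢0

InM-2+-new : ∀ {m w} → ∣ w ∣ ≡ suc (m / 2) → InM (suc (suc m)) w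
InM-2+-new {m} {w} e =
  subst (_≤ suc (suc m) / 2) (sym e) (ℕP.≤-reflexive (sym (2+m/2≡1+m/2 m))) ,
  λ _ → ∣i∣≢0⇒i≢0 (λ ∣w∣≡0 → ℕP.0≢1+n (trans (sym ∣w∣≡0) e))

InM-new≢ : ∀ {m w w'} → ∣ w ∣ ≡ suc (m / 2) → InM m w' → w ≢ w'
InM-new≢ {m} e (∣w'∣≤ , _) refl = ℕP.<-irrefl refl (subst (_≤ m / 2) e ∣w'∣≤)

InM-unit : ∀ {m w} → 3 ≤ m → ∣ w ∣ ≡ 1 → InM m w
InM-unit {suc (suc m)} {w} (s≤s (s≤s _)) e =
  subst (_≤ suc (suc m) / 2) (sym e) (subst (1 ≤_) (sym (2+m/2≡1+m/2 m)) (s≤s z≤n)) ,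
  λ _ → ∣i∣≢0⇒i≢0 (λ ∣w∣≡0 → ℕP.0≢1+n (trans (sym ∣w∣≡0) e))

M : ℕ → List ℤ
M zero = []
M (suc zero) = 0ℤ ∷ []
M (suc (suc m)) = + suc (m / 2) ∷ -[1+ m / 2 ] ∷ M m

length-M : ∀ m → length (M m) ≡ m
length-M zero = refl
length-M (suc zero) = refl
length-M (suc (suc m)) = cong (suc ∘ suc) (length-M m)

InM⇒∈M : ∀ m z → InM m z → z ∈ M m
InM⇒∈M zero z (∣z∣≤0 , z≢0) = ⊥-elim (z≢0 refl (ℤP.∣i∣≡0⇒i≡0 (ℕP.n≤0⇒n≡0 ∣z∣≤0)))
InM⇒∈M (suc zero) z (∣z∣≤0 , _) = here (ℤP.∣i∣≡0⇒i≡0 (ℕP.n≤0⇒n≡0 ∣z∣≤0))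
InM⇒∈M (suc (suc m)) z (∣z∣≤ , z≢0) with ∣ z ∣ ℕ.≟ suc (m / 2)
InM⇒∈M (suc (suc m)) (+ _) _ | yes refl = here refl
InM⇒∈M (suc (suc m)) -[1+ _ ] _ | yes refl = there (here refl)
... | no ∣z∣≢ =
  there (there (InM⇒∈M m z (ℕP.≤-pred (ℕP.≤∧≢⇒< (subst (∣ z ∣ ≤_) (2+m/2≡1+m/2 m) ∣z∣≤) ∣z∣≢) , z≢0)))

injective-into⇒≤length : ∀ {A : Set} {k} {ys : List A} (g : Fin k → A) →
                         (∀ {i j} → g i ≡ g j → i ≡ j) → (∀ i → g i ∈ ys) → k ≤ length ys
injective-into⇒≤length {ys = ys} g g-inj g∈ =
  FinP.injective⇒≤ {f = Any.index ∘ g∈}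
    (λ {i} {j} e → g-inj (trans (AnyP.lookup-index (g∈ i))
                          (trans (cong (lookup ys) e) (sym (AnyP.lookup-index (g∈ j))))))

injective-∷∷ : ∀ {A B : Set} {a b : A} {xs : List A} (f : A → B) → f a ≢ f b →
               All (λ x → f a ≢ f x) xs → All (λ x → f b ≢ f x) xs →
               (∀ {x y} → x ∈ xs → y ∈ xs → f x ≡ f y → x ≡ y) →
               ∀ {x y} → x ∈ a ∷ b ∷ xs → y ∈ a ∷ b ∷ xs → f x ≡ f y → x ≡ y
injective-∷∷ f fa≢fb a≢ b≢ inj (here refl) (here refl) _ = refl
injective-∷∷ f fa≢fb a≢ b≢ inj (here refl) (there (here refl)) e = ⊥-elim (fa≢fb e)
injective-∷∷ f fa≢fb a≢ b≢ inj (here refl) (there (there y∈)) e = ⊥-elim (All.lookup a≢ y∈ e)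
injective-∷∷ f fa≢fb a≢ b≢ inj (there (here refl)) (here refl) e = ⊥-elim (fa≢fb (sym e))
injective-∷∷ f fa≢fb a≢ b≢ inj (there (here refl)) (there (here refl)) _ = refl
injective-∷∷ f fa≢fb a≢ b≢ inj (there (here refl)) (there (there y∈)) e = ⊥-elim (All.lookup b≢ y∈ e)
injective-∷∷ f fa≢fb a≢ b≢ inj (there (there x∈)) (here refl) e = ⊥-elim (All.lookup a≢ x∈ (sym e))
injective-∷∷ f fa≢fb a≢ b≢ inj (there (there x∈)) (there (here refl)) e = ⊥-elim (All.lookup b≢ x∈ (sym e))
injective-∷∷ f fa≢fb a≢ b≢ inj (there (there x∈)) (there (there y∈)) e = inj x∈ y∈ e

lookup-injective : ∀ {A : Set} {xs : List A} → Unique xs → ∀ {i j} → lookup xs i ≡ lookup xs j → i ≡ j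
lookup-injective (_ ∷ _) {Fin.zero} {Fin.zero} _ = refl
lookup-injective (x∉ ∷ _) {Fin.zero} {Fin.suc j} e = ⊥-elim (All.lookup x∉ (∈-lookup j) e)
lookup-injective (x∉ ∷ _) {Fin.suc i} {Fin.zero} e = ⊥-elim (All.lookup x∉ (∈-lookup i) (sym e))
lookup-injective (_ ∷ u) {Fin.suc i} {Fin.suc j} e = cong Fin.suc (lookup-injective u e)

module _ {n : ℕ} (G : Graph n) where

  Adj-sym : ∀ {x y} → Adj G x y → Adj G y x
  Adj-sym {x} {y} = subst T (Graph.sym G x y)

  neighbours : Fin n → List (Fin n)
  neighbours x = filter (T? ∘ adj G x) (allFin n)

  degree≡length-neighbours : ∀ x → degree G x ≡ length (neighbours x)
  degree≡length-neighbours x = go (allFin n)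
    where
      go : ∀ ys → sum (map (λ y → if adj G x y then 1 else 0) ys) ≡ length (filter (T? ∘ adj G x) ys)
      go [] = refl
      go (y ∷ ys) with adj G x y
      ... | true = cong suc (go ys)
      ... | false = go ys

  degree≤ : ∀ {k} x (h : ∀ y → Adj G x y → Fin k) →
            (∀ {y y'} p p' → h y p ≡ h y' p' → y ≡ y') → degree G x ≤ k
  degree≤ x h h-inj = subst (_≤ _) (sym (degree≡length-neighbours x))
    (FinP.injective⇒≤ {f = λ i → h (lookup ys i) (nbr i)}
      (λ e → lookup-injective (UniqueP.filter⁺ (T? ∘ adj G x) (UniqueP.allFin⁺ n)) (h-inj (nbr _) (nbr _) e)))
    where
      ys : List (Fin n)
      ys = neighbours x
      nbr : ∀ i → Adj G x (lookup ys i)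
      nbr i = proj₂ (∈-filter⁻ (T? ∘ adj G x) {xs = allFin n} (∈-lookup i))

  ≤degree : ∀ {k} x (g : Fin k → Fin n) → (∀ {i j} → g i ≡ g j → i ≡ j) →
            (∀ i → Adj G x (g i)) → k ≤ degree G x
  ≤degree x g g-inj adj-g = subst (_ ≤_) (sym (degree≡length-neighbours x))
    (injective-into⇒≤length g g-inj (λ i → ∈-filter⁺ (T? ∘ adj G x) (∈-allFin (g i)) (adj-g i)))

  Δ-lub : ∀ {m} → (∀ x → degree G x ≤ m) → Δ G ≤ m
  Δ-lub {m} deg≤ = go (allFin n)
    where
      go : ∀ xs → foldr _⊔_ 0 (map (degree G) xs) ≤ m
      go [] = z≤n
      go (x ∷ xs) = ℕP.⊔-lub (deg≤ x) (go xs)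

  degree≤Δ : ∀ x → degree G x ≤ Δ G
  degree≤Δ x = go (∈-allFin x)
    where
      go : ∀ {xs} → x ∈ xs → degree G x ≤ foldr _⊔_ 0 (map (degree G) xs)
      go (here refl) = ℕP.m≤m⊔n _ _
      go (there x∈) = ℕP.≤-trans (go x∈) (ℕP.m≤n⊔m _ _)

-- Necklaces with explicitly indexed paths

Step : ∀ {n k : ℕ} → (Fin k → ℕ → Fin n) → Fin k → ℕ → Fin n → Fin n → Set
Step vertex i j a b = a ≡ vertex i j × b ≡ vertex i (suc j)

record IndexedNecklace {n : ℕ} (G : Graph n) : Set where
  field
    u v : Fin n
    k : ℕ
    len : Fin k → ℕ
    vertex : Fin k → ℕ → Fin n
    u≢v : u ≢ v
    2≤k : 2 ≤ k
    1≤len : ∀ i → 1 ≤ len i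
    vertex-start : ∀ i → vertex i 0 ≡ u
    vertex-end : ∀ i → vertex i (len i) ≡ v
    vertex-injective : ∀ i {j j'} → j ≤ len i → j' ≤ len i → vertex i j ≡ vertex i j' → j ≡ j'
    interior-disjoint : ∀ i i' {j j'} → 0 < j → j < len i → j' ≤ len i' →
                        vertex i j ≡ vertex i' j' → i ≡ i'
    step-adjacent : ∀ i {j} → j < len i → Adj G (vertex i j) (vertex i (suc j))
    edge-step : ∀ a b → Adj G a b → Σ (Fin k) λ i → Σ ℕ λ j → j < len i ×
                  (Step vertex i j a b ⊎ Step vertex i j b a)
    single-edge-unique : ∀ i i' → len i ≡ 1 → len i' ≡ 1 → i ≡ i'
    on-path : ∀ x → Σ (Fin k) λ i → Σ ℕ λ j → j ≤ len i × x ≡ vertex i j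

module IndexedNecklaceProperties {n : ℕ} {G : Graph n} (N : IndexedNecklace G) where
  open IndexedNecklace N

  data Position (i : Fin k) (j : ℕ) : Set where
    start : j ≡ 0 → Position i j
    end : j ≡ len i → Position i j
    interior : 0 < j → j < len i → Position i j

  position : ∀ i j → j ≤ len i → Position i j
  position i zero _ = start refl
  position i (suc j) j≤ with suc j ℕ.≟ len i
  ... | yes e = end e
  ... | no ≢len = interior (s≤s z≤n) (ℕP.≤∧≢⇒< j≤ ≢len)

  vertex-coincidence : ∀ i i' {j j'} → j ≤ len i → j' ≤ len i' → vertex i j ≡ vertex i' j' →
                       (i ≡ i' × j ≡ j') ⊎ (j ≡ 0 × j' ≡ 0) ⊎ (j ≡ len i × j' ≡ len i')
  vertex-coincidence i i' {j} {j'} j≤ j'≤ e with position i j j≤ | position i' j' j'≤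
  ... | start refl | start refl = inj₂ (inj₁ (refl , refl))
  ... | start refl | end refl = ⊥-elim (u≢v (trans (sym (vertex-start i)) (trans e (vertex-end i'))))
  ... | end refl | start refl = ⊥-elim (u≢v (trans (sym (vertex-start i')) (trans (sym e) (vertex-end i))))
  ... | end refl | end refl = inj₂ (inj₂ (refl , refl))
  ... | interior 0<j j< | _ with interior-disjoint i i' 0<j j< j'≤ e
  ...   | refl = inj₁ (refl , vertex-injective i j≤ j'≤ e)
  vertex-coincidence i i' j≤ j'≤ e | start refl | interior 0<j' j'<
    with interior-disjoint i' i 0<j' j'< j≤ (sym e)
  ... | refl = ⊥-elim (ℕP.<-irrefl (vertex-injective i j≤ j'≤ e) 0<j')
  vertex-coincidence i i' j≤ j'≤ e | end refl | interior 0<j' j'<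
    with interior-disjoint i' i 0<j' j'< j≤ (sym e)
  ... | refl = ⊥-elim (ℕP.<-irrefl (sym (vertex-injective i j≤ j'≤ e)) j'<)

  step-unique : ∀ {i i' j j' x y} → j < len i → j' < len i' →
                Step vertex i j x y → Step vertex i' j' x y → i ≡ i' × j ≡ j'
  step-unique {i} {i'} {j} {j'} j< j'< (x≡ , y≡) (x≡' , y≡')
    with vertex-coincidence i i' (ℕP.<⇒≤ j<) (ℕP.<⇒≤ j'<) (trans (sym x≡) x≡')
  ... | inj₁ same = same
  ... | inj₂ (inj₂ (refl , _)) = ⊥-elim (ℕP.<-irrefl refl j<)
  ... | inj₂ (inj₁ (refl , refl)) with vertex-coincidence i i' j< j'< (trans (sym y≡) y≡')
  ...   | inj₁ (i≡i' , _) = i≡i' , refl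
  ...   | inj₂ (inj₂ (len≡1 , len'≡1)) = single-edge-unique i i' (sym len≡1) (sym len'≡1) , refl

  step-not-reversed : ∀ {i i' j j' x y} → j < len i → j' < len i' →
                      Step vertex i j x y → Step vertex i' j' y x → ⊥
  step-not-reversed {i} {i'} {j} {j'} j< j'< (x≡ , y≡) (y≡' , x≡')
    with vertex-coincidence i i' (ℕP.<⇒≤ j<) j'< (trans (sym x≡) x≡')
  ... | inj₂ (inj₁ (_ , ()))
  ... | inj₂ (inj₂ (refl , _)) = ℕP.<-irrefl refl j<
  ... | inj₁ (refl , refl) =
    ℕP.<-irrefl (sym (vertex-injective i j< (ℕP.<⇒≤ j'<) (trans (sym y≡) y≡')))
                (ℕP.m<n⇒m<1+n (ℕP.n<1+n j'))

lookupOr : ∀ {A : Set} → List A → A → ℕ → A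
lookupOr [] d _ = d
lookupOr (x ∷ xs) d zero = x
lookupOr (x ∷ xs) d (suc j) = lookupOr xs d j

module _ {A : Set} where

  lookupOr-∈ : ∀ (xs : List A) d {j} → j < length xs → lookupOr xs d j ∈ xs
  lookupOr-∈ (x ∷ xs) d {zero} _ = here refl
  lookupOr-∈ (x ∷ xs) d {suc j} (s≤s j<) = there (lookupOr-∈ xs d j<)

  lookupOr-injective : ∀ {xs : List A} d → Unique xs → ∀ {j j'} → j < length xs → j' < length xs →
                       lookupOr xs d j ≡ lookupOr xs d j' → j ≡ j'
  lookupOr-injective {x ∷ xs} d (_ ∷ _) {zero} {zero} _ _ _ = refl
  lookupOr-injective {x ∷ xs} d (x∉ ∷ _) {zero} {suc j'} _ (s≤s j'<) e =
    ⊥-elim (All.lookup x∉ (lookupOr-∈ xs d j'<) e)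
  lookupOr-injective {x ∷ xs} d (x∉ ∷ _) {suc j} {zero} (s≤s j<) _ e =
    ⊥-elim (All.lookup x∉ (lookupOr-∈ xs d j<) (sym e))
  lookupOr-injective {x ∷ xs} d (_ ∷ u) {suc j} {suc j'} (s≤s j<) (s≤s j'<) e =
    cong suc (lookupOr-injective d u j< j'< e)

  lookupOr-++-length : ∀ (xs : List A) d y ys → lookupOr (xs ++ y ∷ ys) d (length xs) ≡ y
  lookupOr-++-length [] d y ys = refl
  lookupOr-++-length (x ∷ xs) d y ys = lookupOr-++-length xs d y ys

  lookupOr-++ˡ : ∀ (xs : List A) d ys {j} → j < length xs → lookupOr (xs ++ ys) d j ≡ lookupOr xs d j
  lookupOr-++ˡ (x ∷ xs) d ys {zero} _ = refl
  lookupOr-++ˡ (x ∷ xs) d ys {suc j} (s≤s j<) = lookupOr-++ˡ xs d ys j<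

  lookupOr-linked : ∀ {R : A → A → Set} {xs : List A} d → Linked R xs → ∀ {j} → suc j < length xs →
                    R (lookupOr xs d j) (lookupOr xs d (suc j))
  lookupOr-linked d (r ∷ _) {zero} _ = r
  lookupOr-linked d (_ ∷ rs) {suc j} (s≤s j<) = lookupOr-linked d rs j<
  lookupOr-linked d [-] (s≤s ())

  Consec⇒lookupOr : ∀ {a b : A} {xs} d → Consec a b xs →
                    Σ ℕ λ j → suc j < length xs × a ≡ lookupOr xs d j × b ≡ lookupOr xs d (suc j)
  Consec⇒lookupOr d here = 0 , s≤s (s≤s z≤n) , refl , refl
  Consec⇒lookupOr d (there c) with Consec⇒lookupOr d c
  ... | j , j< , a≡ , b≡ = suc j , s≤s j< , a≡ , b≡

  unique-∷ʳ⇒∉ : ∀ (xs : List A) {v x} → Unique (xs ++ v ∷ []) → x ∈ xs → x ≢ v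
  unique-∷ʳ⇒∉ (y ∷ xs) (y∉ ∷ _) (here refl) = All.lookup (AllP.++⁻ʳ xs y∉) (here refl)
  unique-∷ʳ⇒∉ (y ∷ xs) (_ ∷ u) (there x∈) = unique-∷ʳ⇒∉ xs u x∈

indexNecklace : ∀ {n} {G : Graph n} → IsNecklace G → IndexedNecklace G
indexNecklace {n} {G} (connected , u , v , k , mid , u≢v , 2≤k , isPath , disjoint , covered , coveredOnce) =
  record
    { u = u ; v = v ; k = k ; len = len ; vertex = vertex ; u≢v = u≢v ; 2≤k = 2≤k
    ; 1≤len = λ _ → s≤s z≤n ; vertex-start = λ _ → refl ; vertex-end = vertex-end
    ; vertex-injective = λ i j≤ j'≤ → lookupOr-injective u (proj₂ (isPath i)) (≤len i j≤) (≤len i j'≤)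
    ; interior-disjoint = interior-disjoint
    ; step-adjacent = λ i j< → lookupOr-linked u (proj₁ (isPath i)) (≤len i j<)
    ; edge-step = edge-step ; single-edge-unique = single-edge-unique ; on-path = on-path }
  where
    pathList : Fin k → List (Fin n)
    pathList i = path G u v (mid i)

    len : Fin k → ℕ
    len i = suc (length (mid i))

    vertex : Fin k → ℕ → Fin n
    vertex i = lookupOr (pathList i) u

    length-path : ∀ i → length (pathList i) ≡ suc (len i)
    length-path i = cong suc (trans (ListP.length-++ (mid i)) (ℕP.+-comm (length (mid i)) 1))

    ≤len : ∀ i {j} → j ≤ len i → j < length (pathList i)
    ≤len i {j} j≤ = subst (j <_) (sym (length-path i)) (s≤s j≤)

    vertex-end : ∀ i → vertex i (len i) ≡ v
    vertex-end i = lookupOr-++-length (mid i) u v []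

    vertex-interior : ∀ i {j} → j < length (mid i) → vertex i (suc j) ∈ mid i
    vertex-interior i j< = subst (_∈ mid i) (sym (lookupOr-++ˡ (mid i) u (v ∷ []) j<)) (lookupOr-∈ (mid i) u j<)

    u∉mid : ∀ i {x} → x ∈ mid i → x ≢ u
    u∉mid i x∈ x≡u with proj₂ (isPath i)
    ... | u∉ ∷ _ = All.lookup (AllP.++⁻ˡ (mid i) u∉) x∈ (sym x≡u)

    v∉mid : ∀ i {x} → x ∈ mid i → x ≢ v
    v∉mid i x∈ with proj₂ (isPath i)
    ... | _ ∷ unique = unique-∷ʳ⇒∉ (mid i) unique x∈

    interior-disjoint : ∀ i i' {j j'} → 0 < j → j < len i → j' ≤ len i' → vertex i j ≡ vertex i' j' → i ≡ i'
    interior-disjoint i i' {suc j} {zero} _ (s≤s j<) _ e = ⊥-elim (u∉mid i (vertex-interior i j<) e)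
    interior-disjoint i i' {suc j} {suc j'} _ (s≤s j<) (s≤s j'≤) e with j' ℕ.≟ length (mid i')
    ... | yes refl = ⊥-elim (v∉mid i (vertex-interior i j<) (trans e (vertex-end i')))
    ... | no j'≢ = disjoint i i' _ (vertex-interior i j<)
                     (subst (_∈ mid i') (sym e) (vertex-interior i' (ℕP.≤∧≢⇒< j'≤ j'≢)))

    consec⇒step : ∀ {a b} i → Consec a b (pathList i) → Σ ℕ λ j → j < len i × Step vertex i j a b
    consec⇒step i c with Consec⇒lookupOr u c
    ... | j , j< , a≡ , b≡ = j , ℕP.≤-pred (subst (suc j <_) (length-path i) j<) , a≡ , b≡

    edge-step : ∀ a b → Adj G a b → Σ (Fin k) λ i → Σ ℕ λ j → j < len i ×
                  (Step vertex i j a b ⊎ Step vertex i j b a)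
    edge-step a b ab with covered a b ab
    ... | i , inj₁ c with consec⇒step i c
    ...   | j , j< , s = i , j , j< , inj₁ s
    edge-step a b ab | i , inj₂ c with consec⇒step i c
    ...   | j , j< , s = i , j , j< , inj₂ s

    single-edge-unique : ∀ i i' → len i ≡ 1 → len i' ≡ 1 → i ≡ i'
    single-edge-unique i i' e e' = coveredOnce u v i i' (uv-edge i e) (uv-edge i' e')
      where
        uv-edge : ∀ i → len i ≡ 1 → EdgeOf u v (pathList i)
        uv-edge i e with mid i | e
        ... | [] | _ = inj₁ here

    on-path : ∀ x → Σ (Fin k) λ i → Σ ℕ λ j → j ≤ len i × x ≡ vertex i j
    on-path x with connected x u
    ... | ε = path₀ 2≤k , 0 , z≤n , refl
      where
        path₀ : ∀ {m} → 2 ≤ m → Fin m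
        path₀ (s≤s _) = Fin.zero
    on-path x | _◅_ {j = y} xy _ with edge-step x y xy
    ... | i , j , j< , inj₁ (x≡ , _) = i , j , ℕP.<⇒≤ j< , x≡
    ... | i , j , j< , inj₂ (_ , x≡) = i , suc j , j< , x≡

-- A necklace with two paths is a cycle

m∸n≡1+m∸1+n : ∀ {m n} → n < m → m ∸ n ≡ suc (m ∸ suc n)
m∸n≡1+m∸1+n = ℕP.+-∸-assoc 1

-- CycSucc G i j is Succ n (toℕ i) (toℕ j)
Succ : ℕ → ℕ → ℕ → Set
Succ ℓ t t' = suc t ≡ t' ⊎ (suc t ≡ ℓ × t' ≡ 0)

module TwoPaths {n : ℕ} {G : Graph n} (N : IndexedNecklace G) (a b : Fin (IndexedNecklace.k N))
                (a≢b : a ≢ b) (a-or-b : ∀ i → i ≡ a ⊎ i ≡ b) where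
  open IndexedNecklace N
  open IndexedNecklaceProperties N

  p q ℓ : ℕ
  p = len a
  q = len b
  ℓ = p + q

  3≤ℓ : 3 ≤ ℓ
  3≤ℓ with p ℕ.≟ 1 | q ℕ.≟ 1
  ... | yes p≡1 | yes q≡1 = ⊥-elim (a≢b (single-edge-unique a b p≡1 q≡1))
  ... | yes p≡1 | no q≢1 = subst (λ x → 3 ≤ x + q) (sym p≡1) (s≤s (ℕP.≤∧≢⇒< (1≤len b) (λ e → q≢1 (sym e))))
  ... | no p≢1 | _ = ℕP.+-mono-≤ (ℕP.≤∧≢⇒< (1≤len a) (λ e → p≢1 (sym e))) (1≤len b)

  p<ℓ : p < ℓ
  p<ℓ = subst (_≤ ℓ) (ℕP.+-comm p 1) (ℕP.+-monoʳ-≤ p (1≤len b))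

  -- out along path a, back along path b
  around : ℕ → Fin n
  around t with t ℕ.≤? p
  ... | yes _ = vertex a t
  ... | no _ = vertex b (ℓ ∸ t)

  around-a : ∀ {t} → t ≤ p → around t ≡ vertex a t
  around-a {t} t≤p with t ℕ.≤? p
  ... | yes _ = refl
  ... | no t≰p = ⊥-elim (t≰p t≤p)

  around-b : ∀ {t} → p ≤ t → around t ≡ vertex b (ℓ ∸ t)
  around-b {t} p≤t with t ℕ.≤? p
  ... | no _ = refl
  ... | yes t≤p with ℕP.≤-antisym t≤p p≤t
  ...   | refl = trans (vertex-end a) (trans (sym (vertex-end b)) (cong (vertex b) (sym (ℕP.m+n∸m≡n p q))))

  b-interior : ∀ {t} → p < t → t < ℓ → 0 < ℓ ∸ t × ℓ ∸ t < q
  b-interior {t} p<t t<ℓ = ℕP.m<n⇒0<n∸m t<ℓ , subst (ℓ ∸ t <_) (ℕP.m+n∸m≡n p q) (ℕP.∸-monoʳ-< p<t (ℕP.<⇒≤ t<ℓ))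

  around-injective : ∀ {t t'} → t < ℓ → t' < ℓ → around t ≡ around t' → t ≡ t'
  around-injective {t} {t'} t<ℓ t'<ℓ e with t ℕ.≤? p | t' ℕ.≤? p
  ... | yes t≤p | yes t'≤p = vertex-injective a t≤p t'≤p e
  ... | yes t≤p | no t'≰p = ⊥-elim (a≢b (sym (interior-disjoint b a 0< <q t≤p (sym e))))
    where open Σ (b-interior (ℕP.≰⇒> t'≰p) t'<ℓ) renaming (proj₁ to 0<; proj₂ to <q)
  ... | no t≰p | yes t'≤p = ⊥-elim (a≢b (sym (interior-disjoint b a 0< <q t'≤p e)))
    where open Σ (b-interior (ℕP.≰⇒> t≰p) t<ℓ) renaming (proj₁ to 0<; proj₂ to <q)
  ... | no t≰p | no t'≰p =
    ℕP.∸-cancelˡ-≡ (ℕP.<⇒≤ t<ℓ) (ℕP.<⇒≤ t'<ℓ)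
      (vertex-injective b (ℕP.<⇒≤ (proj₂ (b-interior (ℕP.≰⇒> t≰p) t<ℓ)))
                          (ℕP.<⇒≤ (proj₂ (b-interior (ℕP.≰⇒> t'≰p) t'<ℓ))) e)

  around-0 : around 0 ≡ vertex b 0
  around-0 = trans (around-a z≤n) (trans (vertex-start a) (sym (vertex-start b)))

  around-succ : ∀ {t t'} → Succ ℓ t t' → t' < ℓ → Adj G (around t) (around t')
  around-succ {t} (inj₁ refl) t'<ℓ with p ℕ.≤? t
  ... | no p≰t = subst₂ (Adj G) (sym (around-a (ℕP.<⇒≤ t<p))) (sym (around-a t<p)) (step-adjacent a t<p)
    where
      t<p : t < p
      t<p = ℕP.≰⇒> p≰t
  ... | yes p≤t =
    subst₂ (Adj G) (sym (trans (around-b p≤t) (cong (vertex b) (m∸n≡1+m∸1+n (ℕP.<-trans (ℕP.n<1+n t) t'<ℓ)))))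
                   (sym (around-b (ℕP.m≤n⇒m≤1+n p≤t)))
                   (Adj-sym G (step-adjacent b (proj₂ (b-interior (s≤s p≤t) t'<ℓ))))
  around-succ {t} (inj₂ (1+t≡ℓ , refl)) _ =
    subst₂ (Adj G) (sym (trans (around-b p≤t) (cong (vertex b) ℓ∸t≡1))) (sym around-0)
           (Adj-sym G (step-adjacent b (1≤len b)))
    where
      p≤t : p ≤ t
      p≤t = ℕP.≤-pred (subst (p <_) (sym 1+t≡ℓ) p<ℓ)
      ℓ∸t≡1 : ℓ ∸ t ≡ 1
      ℓ∸t≡1 = trans (cong (_∸ t) (sym 1+t≡ℓ)) (ℕP.m+n∸n≡m 1 t)

  ≢a⇒≡b : ∀ {i} → i ≢ a → i ≡ b
  ≢a⇒≡b {i} i≢a with a-or-b i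
  ... | inj₁ i≡a = ⊥-elim (i≢a i≡a)
  ... | inj₂ i≡b = i≡b

  back : ℕ → ℕ
  back zero = 0
  back (suc j) = ℓ ∸ suc j

  index : Fin k → ℕ → ℕ
  index i j with i FinP.≟ a
  ... | yes _ = j
  ... | no _ = back j

  back-correct : ∀ j → j ≤ q → back j < ℓ × around (back j) ≡ vertex b j
  back-correct zero _ = ℕP.<-≤-trans (s≤s z≤n) 3≤ℓ , around-0
  back-correct (suc j) 1+j≤q =
    ℕP.∸-monoʳ-< (s≤s z≤n) 1+j≤ℓ , trans (around-b p≤) (cong (vertex b) (ℕP.m∸[m∸n]≡n 1+j≤ℓ))
    where
      1+j≤ℓ : suc j ≤ ℓ
      1+j≤ℓ = ℕP.≤-trans 1+j≤q (ℕP.m≤n+m q p)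
      p≤ : p ≤ ℓ ∸ suc j
      p≤ = subst (_≤ ℓ ∸ suc j) (ℕP.m+n∸n≡m p q) (ℕP.∸-monoʳ-≤ ℓ 1+j≤q)

  index-correct : ∀ i j → j ≤ len i → index i j < ℓ × around (index i j) ≡ vertex i j
  index-correct i j j≤ with i FinP.≟ a
  ... | yes refl = ℕP.≤-<-trans j≤ p<ℓ , around-a j≤
  ... | no i≢a with ≢a⇒≡b i≢a
  ...   | refl = back-correct j j≤

  index-step : ∀ i j → j < len i → Succ ℓ (index i j) (index i (suc j)) ⊎ Succ ℓ (index i (suc j)) (index i j)
  index-step i j j< with i FinP.≟ a
  ... | yes _ = inj₁ (inj₁ refl)
  ... | no i≢a with ≢a⇒≡b i≢a
  index-step i zero j< | no _ | refl =
    inj₂ (inj₂ (sym (m∸n≡1+m∸1+n (ℕP.<-≤-trans (s≤s z≤n) 3≤ℓ)) , refl))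
  index-step i (suc j) j< | no _ | refl =
    inj₂ (inj₁ (sym (m∸n≡1+m∸1+n (ℕP.<-≤-trans j< (ℕP.m≤n+m q p)))))

  step⇒succ : ∀ {i j t t'} → j < len i → t < ℓ → t' < ℓ →
              Step vertex i j (around t) (around t') → Succ ℓ t t' ⊎ Succ ℓ t' t
  step⇒succ {i} {j} j< t<ℓ t'<ℓ (e , e') =
    subst₂ (λ x y → Succ ℓ x y ⊎ Succ ℓ y x) (sym (at j (ℕP.<⇒≤ j<) t<ℓ e)) (sym (at (suc j) j< t'<ℓ e'))
           (index-step i j j<)
    where
      at : ∀ {t} j → j ≤ len i → t < ℓ → around t ≡ vertex i j → t ≡ index i j
      at j j≤ t<ℓ e =
        around-injective t<ℓ (proj₁ (index-correct i j j≤)) (trans e (sym (proj₂ (index-correct i j j≤))))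

  ℓ≤n : ℓ ≤ n
  ℓ≤n = FinP.injective⇒≤ {f = λ (t : Fin ℓ) → around (toℕ t)}
          (λ e → FinP.toℕ-injective (around-injective (FinP.toℕ<n _) (FinP.toℕ<n _) e))

  around-onto : ∀ x → Σ ℕ λ t → t < ℓ × around t ≡ x
  around-onto x with on-path x
  ... | i , j , j≤ , x≡ = index i j , proj₁ (index-correct i j j≤) , trans (proj₂ (index-correct i j j≤)) (sym x≡)

  cyclePosition : Fin n → Fin ℓ
  cyclePosition x = Fin.fromℕ< (proj₁ (proj₂ (around-onto x)))

  around-cyclePosition : ∀ x → around (toℕ (cyclePosition x)) ≡ x
  around-cyclePosition x =
    trans (cong around (FinP.toℕ-fromℕ< (proj₁ (proj₂ (around-onto x))))) (proj₂ (proj₂ (around-onto x)))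

  n≤ℓ : n ≤ ℓ
  n≤ℓ = FinP.injective⇒≤ {f = cyclePosition}
          (λ {x} {y} e → trans (sym (around-cyclePosition x))
                               (trans (cong (around ∘ toℕ) e) (around-cyclePosition y)))

  n≡ℓ : n ≡ ℓ
  n≡ℓ = ℕP.≤-antisym n≤ℓ ℓ≤n

  isCycle : IsCycle G
  isCycle = subst (3 ≤_) (sym n≡ℓ) 3≤ℓ , π , π-injective , adjacent⇒succ , succ⇒adjacent
    where
      π : Fin n → Fin n
      π i = around (toℕ i)
      <ℓ : ∀ (i : Fin n) → toℕ i < ℓ
      <ℓ i = subst (toℕ i <_) n≡ℓ (FinP.toℕ<n i)
      π-injective : ∀ i j → π i ≡ π j → i ≡ j
      π-injective i j e = FinP.toℕ-injective (around-injective (<ℓ i) (<ℓ j) e)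
      adjacent⇒succ : ∀ i j → Adj G (π i) (π j) → CycSucc G i j ⊎ CycSucc G j i
      adjacent⇒succ i j πiπj with edge-step (π i) (π j) πiπj
      ... | _ , _ , s< , inj₁ st = subst (λ m → Succ m (toℕ i) (toℕ j) ⊎ Succ m (toℕ j) (toℕ i)) (sym n≡ℓ)
                                         (step⇒succ s< (<ℓ i) (<ℓ j) st)
      ... | _ , _ , s< , inj₂ st = subst (λ m → Succ m (toℕ i) (toℕ j) ⊎ Succ m (toℕ j) (toℕ i)) (sym n≡ℓ)
                                         (swap (step⇒succ s< (<ℓ j) (<ℓ i) st))
      succ⇒adjacent : ∀ i j → CycSucc G i j ⊎ CycSucc G j i → Adj G (π i) (π j)
      succ⇒adjacent i j (inj₁ ij) = around-succ (subst (λ m → Succ m (toℕ i) (toℕ j)) n≡ℓ ij) (<ℓ j)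
      succ⇒adjacent i j (inj₂ ji) = Adj-sym G (around-succ (subst (λ m → Succ m (toℕ j) (toℕ i)) n≡ℓ ji) (<ℓ i))

twoPaths⇒cycle : ∀ {n} {G : Graph n} (N : IndexedNecklace G) → IndexedNecklace.k N ≡ 2 → IsCycle G
twoPaths⇒cycle N refl = TwoPaths.isCycle N Fin.zero (Fin.suc Fin.zero) (λ ()) zero-or-one
  where
    zero-or-one : ∀ (i : Fin 2) → i ≡ Fin.zero ⊎ i ≡ Fin.suc Fin.zero
    zero-or-one Fin.zero = inj₁ refl
    zero-or-one (Fin.suc Fin.zero) = inj₂ refl

-- Maximum degree and the lower bound

module Degrees {n : ℕ} {G : Graph n} (N : IndexedNecklace G) where
  open IndexedNecklace N
  open IndexedNecklaceProperties N

  second : Fin k → Fin n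
  second i = vertex i 1

  second-injective : ∀ {i i'} → second i ≡ second i' → i ≡ i'
  second-injective {i} {i'} e with vertex-coincidence i i' (1≤len i) (1≤len i') e
  ... | inj₁ (i≡i' , _) = i≡i'
  ... | inj₂ (inj₂ (len≡1 , len'≡1)) = single-edge-unique i i' (sym len≡1) (sym len'≡1)

  adj-second : ∀ i → Adj G u (second i)
  adj-second i = subst (λ z → Adj G z (second i)) (vertex-start i) (step-adjacent i (1≤len i))

  neighbour-of-u : ∀ y (uy : Adj G u y) → y ≡ second (proj₁ (edge-step u y uy))
  neighbour-of-u y uy with edge-step u y uy
  ... | i , j , j< , inj₁ (u≡ , y≡)
    with vertex-injective i (ℕP.<⇒≤ j<) z≤n (trans (sym u≡) (sym (vertex-start i)))
  ...   | refl = y≡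
  neighbour-of-u y uy | i , j , j< , inj₂ (_ , u≡)
    with vertex-injective i j< z≤n (trans (sym u≡) (sym (vertex-start i)))
  ...   | ()

  neighbour-of-v : ∀ y (vy : Adj G v y) → Σ ℕ λ j →
                   suc j ≡ len (proj₁ (edge-step v y vy)) × y ≡ vertex (proj₁ (edge-step v y vy)) j
  neighbour-of-v y vy with edge-step v y vy
  ... | i , j , j< , inj₁ (v≡ , _) =
    ⊥-elim (ℕP.<-irrefl (vertex-injective i (ℕP.<⇒≤ j<) ℕP.≤-refl (trans (sym v≡) (sym (vertex-end i)))) j<)
  ... | i , j , j< , inj₂ (y≡ , v≡) =
    j , vertex-injective i j< ℕP.≤-refl (trans (sym v≡) (sym (vertex-end i))) , y≡

  k≤degree-u : k ≤ degree G u
  k≤degree-u = ≤degree G u second second-injective adj-second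

  degree-u≤k : degree G u ≤ k
  degree-u≤k = degree≤ G u (λ y uy → proj₁ (edge-step u y uy))
    (λ {y} {y'} uy uy' e → trans (neighbour-of-u y uy) (trans (cong second e) (sym (neighbour-of-u y' uy'))))

  degree-v≤k : degree G v ≤ k
  degree-v≤k = degree≤ G v (λ y vy → proj₁ (edge-step v y vy)) injective
    where
      injective : ∀ {y y'} vy vy' → proj₁ (edge-step v y vy) ≡ proj₁ (edge-step v y' vy') → y ≡ y'
      injective {y} {y'} vy vy' e with neighbour-of-v y vy | neighbour-of-v y' vy'
      ... | j , j≡ , y≡ | j' , j'≡ , y'≡ =
        trans y≡ (trans (cong₂ vertex e (ℕP.suc-injective (trans j≡ (trans (cong len e) (sym j'≡))))) (sym y'≡))

  degree-interior≤2 : ∀ x → x ≢ u → x ≢ v → degree G x ≤ 2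
  degree-interior≤2 x x≢u x≢v = degree≤ G x direction direction-injective
    where
      direction : ∀ y → Adj G x y → Fin 2
      direction y xy with edge-step x y xy
      ... | _ , _ , _ , inj₁ _ = Fin.zero
      ... | _ , _ , _ , inj₂ _ = Fin.suc Fin.zero

      direction-injective : ∀ {y y'} xy xy' → direction y xy ≡ direction y' xy' → y ≡ y'
      direction-injective {y} {y'} xy xy' e with edge-step x y xy | edge-step x y' xy'
      ... | i , j , j< , inj₁ (x≡ , y≡) | i' , j' , j'< , inj₁ (x≡' , y≡')
        with vertex-coincidence i i' (ℕP.<⇒≤ j<) (ℕP.<⇒≤ j'<) (trans (sym x≡) x≡')
      ...   | inj₁ (refl , refl) = trans y≡ (sym y≡')
      ...   | inj₂ (inj₁ (refl , _)) = ⊥-elim (x≢u (trans x≡ (vertex-start i)))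
      ...   | inj₂ (inj₂ (refl , _)) = ⊥-elim (ℕP.<-irrefl refl j<)
      direction-injective xy xy' () | _ , _ , _ , inj₁ _ | _ , _ , _ , inj₂ _
      direction-injective xy xy' () | _ , _ , _ , inj₂ _ | _ , _ , _ , inj₁ _
      direction-injective {y} {y'} xy xy' e | i , j , j< , inj₂ (y≡ , x≡) | i' , j' , j'< , inj₂ (y≡' , x≡')
        with vertex-coincidence i i' j< j'< (trans (sym x≡) x≡')
      ...   | inj₁ (refl , refl) = trans y≡ (sym y≡')
      ...   | inj₂ (inj₂ (1+j≡len , _)) = ⊥-elim (x≢v (trans x≡ (trans (cong (vertex i) 1+j≡len) (vertex-end i))))

  Δ≡k : Δ G ≡ k
  Δ≡k = ℕP.≤-antisym (Δ-lub G degree≤k) (ℕP.≤-trans k≤degree-u (degree≤Δ G u))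
    where
      degree≤k : ∀ x → degree G x ≤ k
      degree≤k x with x FinP.≟ u | x FinP.≟ v
      ... | yes refl | _ = degree-u≤k
      ... | no _ | yes refl = degree-v≤k
      ... | no x≢u | no x≢v = ℕP.≤-trans (degree-interior≤2 x x≢u x≢v) 2≤k

  k≤colours : ∀ {σ} {m} → EdgeColoring G σ m → k ≤ m
  k≤colours {m = m} (f , f∈M , _ , f-proper) = subst (k ≤_) (length-M m)
    (injective-into⇒≤length (λ i → f u (second i)) at-u-injective (λ i → InM⇒∈M m _ (f∈M u _ (adj-second i))))
    where
      at-u-injective : ∀ {i j} → f u (second i) ≡ f u (second j) → i ≡ j
      at-u-injective {i} {j} e with i FinP.≟ j
      ... | yes i≡j = i≡j
      ... | no i≢j = ⊥-elim (f-proper u _ _ (adj-second i) (adj-second j) (i≢j ∘ second-injective) e)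

-- End colours of the paths

-- a path is described by its sign product and whether it is a single edge
Attr : Set
Attr = Sign × Bool

-- c and b, the colours at u and at v of a path with sign product s, extend to a colouring of
-- the path: for a single edge b is determined by c; otherwise only b = s c is excluded, which is
-- what a path with two edges requires
Compatible : Attr → ℤ × ℤ → Set
Compatible (s , single) (c , b) =
  (single ≡ true → b ≡ - (signℤ s ℤ.* c)) × (single ≡ false → b ≢ signℤ s ℤ.* c)

AdmissibleEnds : ℕ → Attr → ℤ × ℤ → Set
AdmissibleEnds m a (c , b) = InM m c × InM m b × Compatible a (c , b)

ListEndColouring : ℕ → List Attr → List (ℤ × ℤ) → Set
ListEndColouring m as cbs = Pointwise (AdmissibleEnds m) as cbs × Unique (map proj₁ cbs) × Unique (map proj₂ cbs)

AtMostOneSingle : List Attr → Set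
AtMostOneSingle = AllPairs (λ a a' → ¬ (proj₂ a ≡ true × proj₂ a' ≡ true))

InM? : ∀ m z → Dec (InM m z)
InM? m z = (∣ z ∣ ℕ.≤? m / 2) ×-dec (m % 2 ℕ.≟ 0 →-dec ¬? (z ℤ.≟ 0ℤ))

listEndColouring? : ∀ m as cbs → Dec (ListEndColouring m as cbs)
listEndColouring? m as cbs =
  PointwiseP.decidable admissible? as cbs ×-dec UniqueDec.unique? ℤ._≟_ _ ×-dec UniqueDec.unique? ℤ._≟_ _
  where
    admissible? : ∀ a cb → Dec (AdmissibleEnds m a cb)
    admissible? (s , single) (c , b) = InM? m c ×-dec InM? m b ×-dec
      ((single Bool.≟ true) →-dec (b ℤ.≟ - (signℤ s ℤ.* c))) ×-dec
      ((single Bool.≟ false) →-dec ¬? (b ℤ.≟ signℤ s ℤ.* c))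

atMostOneSingle? : ∀ as → Dec (AtMostOneSingle as)
atMostOneSingle? = allPairs? (λ a a' → ¬? ((proj₂ a Bool.≟ true) ×-dec (proj₂ a' Bool.≟ true)))

vectors : ∀ {A : Set} → List A → ℕ → List (List A)
vectors xs zero = [] ∷ []
vectors xs (suc n) = concatMap (λ x → map (x ∷_) (vectors xs n)) xs

∈-vectors : ∀ {A : Set} {xs ys : List A} → All (_∈ xs) ys → ys ∈ vectors xs (length ys)
∈-vectors [] = here refl
∈-vectors {xs = xs} (y∈ ∷ ys∈) = ∈-concatMap⁺ _ (Any.map (λ { refl → ∈-map⁺ _ (∈-vectors ys∈) }) y∈)

insertions : ∀ {A : Set} → A → List A → List (List A)
insertions x [] = (x ∷ []) ∷ []
insertions x (y ∷ ys) = (x ∷ y ∷ ys) ∷ map (y ∷_) (insertions x ys)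

permutations : ∀ {A : Set} → List A → List (List A)
permutations [] = [] ∷ []
permutations (x ∷ xs) = concatMap (insertions x) (permutations xs)

attrs : List Attr
attrs = (⊕ , false) ∷ (⊕ , true) ∷ (⊖ , false) ∷ (⊖ , true) ∷ []

∈-attrs : ∀ a → a ∈ attrs
∈-attrs (⊕ , false) = here refl
∈-attrs (⊕ , true) = there (here refl)
∈-attrs (⊖ , false) = there (there (here refl))
∈-attrs (⊖ , true) = there (there (there (here refl)))

candidateEnds : ℕ → List (List (ℤ × ℤ))
candidateEnds m = concatMap (λ cs → map (zip cs) (permutations (M m))) (permutations (M m))

SolvableBySearch : ℕ → Set
SolvableBySearch m =
  All (λ as → AtMostOneSingle as → Any (ListEndColouring m as) (candidateEnds m)) (vectors attrs m)

solvableBySearch? : ∀ m → Dec (SolvableBySearch m)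
solvableBySearch? m = all? (λ as → atMostOneSingle? as →-dec any? (listEndColouring? m as) (candidateEnds m)) _

solvableBySearch-3 : SolvableBySearch 3
solvableBySearch-3 = toWitness {a? = solvableBySearch? 3} tt

solvableBySearch-4 : SolvableBySearch 4
solvableBySearch-4 = toWitness {a? = solvableBySearch? 4} tt

module EndColours {K : ℕ} (parity : Fin K → Sign) (single : Fin K → Bool)
                  (single-unique : ∀ i j → single i ≡ true → single j ≡ true → i ≡ j) where

  attr : Fin K → Attr
  attr i = parity i , single i

  record EndColouring (xs : List (Fin K)) (m : ℕ) : Set where
    field
      atU atV : Fin K → ℤ
      atU∈M : ∀ {i} → i ∈ xs → InM m (atU i)
      atV∈M : ∀ {i} → i ∈ xs → InM m (atV i)
      compatible : ∀ {i} → i ∈ xs → Compatible (attr i) (atU i , atV i)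
      atU-injective : ∀ {i j} → i ∈ xs → j ∈ xs → atU i ≡ atU j → i ≡ j
      atV-injective : ∀ {i j} → i ∈ xs → j ∈ xs → atV i ≡ atV j → i ≡ j

  restrict : ∀ {xs ys m} → (∀ {i} → i ∈ ys → i ∈ xs) → EndColouring xs m → EndColouring ys m
  restrict ys⊆xs E = record
    { atU = atU ; atV = atV ; atU∈M = atU∈M ∘ ys⊆xs ; atV∈M = atV∈M ∘ ys⊆xs ; compatible = compatible ∘ ys⊆xs
    ; atU-injective = λ i∈ j∈ → atU-injective (ys⊆xs i∈) (ys⊆xs j∈)
    ; atV-injective = λ i∈ j∈ → atV-injective (ys⊆xs i∈) (ys⊆xs j∈) }
    where open EndColouring E

  private
    lookupEnds : List (Fin K) → List (ℤ × ℤ) → Fin K → ℤ × ℤ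
    lookupEnds (x ∷ xs) (cb ∷ cbs) i with i FinP.≟ x
    ... | yes _ = cb
    ... | no _ = lookupEnds xs cbs i
    lookupEnds _ _ _ = 0ℤ , 0ℤ

    lookupEnds-∈ : ∀ {R : Attr → ℤ × ℤ → Set} xs cbs → Pointwise R (map attr xs) cbs →
                   ∀ {i} → i ∈ xs → lookupEnds xs cbs i ∈ cbs × R (attr i) (lookupEnds xs cbs i)
    lookupEnds-∈ (x ∷ xs) (cb ∷ cbs) (r ∷ rs) {i} i∈ with i FinP.≟ x
    ... | yes refl = here refl , r
    ... | no i≢x = map₁ there (lookupEnds-∈ xs cbs rs (Any.tail i≢x i∈))

    lookupEnds-injective : ∀ {R : Attr → ℤ × ℤ → Set} (f : ℤ × ℤ → ℤ) xs cbs → Pointwise R (map attr xs) cbs →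
                           Unique (map f cbs) → ∀ {i j} → i ∈ xs → j ∈ xs →
                           f (lookupEnds xs cbs i) ≡ f (lookupEnds xs cbs j) → i ≡ j
    lookupEnds-injective f (x ∷ xs) (cb ∷ cbs) (r ∷ rs) (f∉ ∷ u) {i} {j} i∈ j∈ e with i FinP.≟ x | j FinP.≟ x
    ... | yes i≡x | yes j≡x = trans i≡x (sym j≡x)
    ... | yes _ | no j≢x =
      ⊥-elim (All.lookup f∉ (∈-map⁺ f (proj₁ (lookupEnds-∈ xs cbs rs (Any.tail j≢x j∈)))) e)
    ... | no i≢x | yes _ =
      ⊥-elim (All.lookup f∉ (∈-map⁺ f (proj₁ (lookupEnds-∈ xs cbs rs (Any.tail i≢x i∈)))) (sym e))
    ... | no i≢x | no j≢x = lookupEnds-injective f xs cbs rs u (Any.tail i≢x i∈) (Any.tail j≢x j∈) e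

  fromList : ∀ {m} xs cbs → ListEndColouring m (map attr xs) cbs → EndColouring xs m
  fromList {m} xs cbs (admissible , uniqueU , uniqueV) = record
    { atU = proj₁ ∘ lookupEnds xs cbs
    ; atV = proj₂ ∘ lookupEnds xs cbs
    ; atU∈M = λ i∈ → proj₁ (ends i∈)
    ; atV∈M = λ i∈ → proj₁ (proj₂ (ends i∈))
    ; compatible = λ i∈ → proj₂ (proj₂ (ends i∈))
    ; atU-injective = lookupEnds-injective proj₁ xs cbs admissible uniqueU
    ; atV-injective = lookupEnds-injective proj₂ xs cbs admissible uniqueV }
    where
      ends : ∀ {i} → i ∈ xs → AdmissibleEnds m (attr i) (lookupEnds xs cbs i)
      ends i∈ = proj₂ (lookupEnds-∈ xs cbs admissible i∈)

  single⇒others-not : ∀ {i j} → single i ≡ true → i ≢ j → single j ≡ false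
  single⇒others-not {i} {j} si i≢j with single j in sj
  ... | true = ⊥-elim (i≢j (single-unique i j si sj))
  ... | false = refl

  atMostOneSingle : ∀ {xs} → Unique xs → AtMostOneSingle (map attr xs)
  atMostOneSingle [] = []
  atMostOneSingle {x ∷ _} (x∉ ∷ u) =
    AllP.map⁺ (All.map (λ x≢y (sx , sy) → x≢y (single-unique x _ sx sy)) x∉) ∷ atMostOneSingle u

  bySearch : ∀ {m} xs → Unique xs → length xs ≡ m → SolvableBySearch m → EndColouring xs m
  bySearch xs u refl solvable =
    fromList xs _ (proj₂ (Any.satisfied (All.lookup solvable attrs∈ (atMostOneSingle u))))
    where
      attrs∈ : map attr xs ∈ vectors attrs (length xs)
      attrs∈ = subst (λ n → map attr xs ∈ vectors attrs n) (ListP.length-map attr xs)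
                     (∈-vectors (All.universal ∈-attrs (map attr xs)))

  -- p and q receive the colours ±(m/2 + 1) missing from M_m at u, and their reflections at v
  extend : ∀ {m p q ys} → Unique (p ∷ q ∷ ys) → parity p ≡ parity q → single p ≡ false → single q ≡ false →
           EndColouring ys m → EndColouring (p ∷ q ∷ ys) (suc (suc m))
  extend {m} {p} {q} {ys} ((p≢q ∷ p∉) ∷ q∉ ∷ _) parity≡ p-multi q-multi E = record
    { atU = proj₁ ∘ ends′ ; atV = proj₂ ∘ ends′ ; atU∈M = atU′∈M ; atV∈M = atV′∈M ; compatible = compatible′
    ; atU-injective = atU′-injective ; atV-injective = atV′-injective }
    where
      open EndColouring E

      t : ℤ
      t = + suc (m / 2)

      reflected : ℤ → ℤ × ℤ
      reflected c = c , - (signℤ (parity p) ℤ.* c)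

      ends′ : Fin K → ℤ × ℤ
      ends′ i with i FinP.≟ p | i FinP.≟ q
      ... | yes _ | _ = reflected t
      ... | no _ | yes _ = reflected (- t)
      ... | no _ | no _ = atU i , atV i

      ends′-p : ends′ p ≡ reflected t
      ends′-p with p FinP.≟ p
      ... | yes _ = refl
      ... | no p≢p = ⊥-elim (p≢p refl)

      ends′-q : ends′ q ≡ reflected (- t)
      ends′-q with q FinP.≟ p | q FinP.≟ q
      ... | yes q≡p | _ = ⊥-elim (p≢q (sym q≡p))
      ... | no _ | yes _ = refl
      ... | no _ | no q≢q = ⊥-elim (q≢q refl)

      ends′-old : ∀ {i} → i ∈ ys → ends′ i ≡ (atU i , atV i)
      ends′-old {i} i∈ with i FinP.≟ p | i FinP.≟ q
      ... | yes refl | _ = ⊥-elim (All.lookup p∉ i∈ refl)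
      ... | no _ | yes refl = ⊥-elim (All.lookup q∉ i∈ refl)
      ... | no _ | no _ = refl

      ∣reflected∣ : ∀ c → ∣ proj₂ (reflected c) ∣ ≡ ∣ c ∣
      ∣reflected∣ = ∣-signℤ-*∣ (parity p)

      atU′∈M : ∀ {i} → i ∈ p ∷ q ∷ ys → InM (suc (suc m)) (proj₁ (ends′ i))
      atU′∈M (here refl) rewrite ends′-p = InM-2+-new {m} refl
      atU′∈M (there (here refl)) rewrite ends′-q = InM-2+-new {m} refl
      atU′∈M (there (there i∈)) rewrite ends′-old i∈ = InM-2+ {m} (atU∈M i∈)

      atV′∈M : ∀ {i} → i ∈ p ∷ q ∷ ys → InM (suc (suc m)) (proj₂ (ends′ i))
      atV′∈M (here refl) rewrite ends′-p = InM-2+-new {m} (∣reflected∣ t)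
      atV′∈M (there (here refl)) rewrite ends′-q = InM-2+-new {m} (∣reflected∣ (- t))
      atV′∈M (there (there i∈)) rewrite ends′-old i∈ = InM-2+ {m} (atV∈M i∈)

      reflected-compatible : ∀ {i} c → parity i ≡ parity p → single i ≡ false → c ≢ 0ℤ →
                             Compatible (attr i) (reflected c)
      reflected-compatible {i} c parity≡ multi c≢0 =
        (λ s → ⊥-elim (true≢false (trans (sym s) multi))) ,
        λ _ → subst (λ s → - (signℤ s ℤ.* c) ≢ signℤ (parity i) ℤ.* c) parity≡ (-signℤ-*≢signℤ-* (parity i) c≢0)
        where
          true≢false : true ≢ false
          true≢false ()

      compatible′ : ∀ {i} → i ∈ p ∷ q ∷ ys → Compatible (attr i) (ends′ i)
      compatible′ (here refl) rewrite ends′-p = reflected-compatible t refl p-multi (λ ())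
      compatible′ (there (here refl)) rewrite ends′-q = reflected-compatible (- t) (sym parity≡) q-multi (λ ())
      compatible′ (there (there i∈)) rewrite ends′-old i∈ = compatible i∈

      atU′-injective : ∀ {i j} → i ∈ p ∷ q ∷ ys → j ∈ p ∷ q ∷ ys → proj₁ (ends′ i) ≡ proj₁ (ends′ j) → i ≡ j
      atU′-injective = injective-∷∷ (proj₁ ∘ ends′)
        (subst₂ _≢_ (sym (cong proj₁ ends′-p)) (sym (cong proj₁ ends′-q)) λ ())
        (All.tabulate λ i∈ → subst₂ _≢_ (sym (cong proj₁ ends′-p)) (sym (cong proj₁ (ends′-old i∈)))
                                (InM-new≢ {m} refl (atU∈M i∈)))
        (All.tabulate λ i∈ → subst₂ _≢_ (sym (cong proj₁ ends′-q)) (sym (cong proj₁ (ends′-old i∈)))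
                                (InM-new≢ {m} refl (atU∈M i∈)))
        (λ i∈ j∈ e → atU-injective i∈ j∈
                       (trans (sym (cong proj₁ (ends′-old i∈))) (trans e (cong proj₁ (ends′-old j∈)))))

      atV′-injective : ∀ {i j} → i ∈ p ∷ q ∷ ys → j ∈ p ∷ q ∷ ys → proj₂ (ends′ i) ≡ proj₂ (ends′ j) → i ≡ j
      atV′-injective = injective-∷∷ (proj₂ ∘ ends′)
        (subst₂ _≢_ (sym (cong proj₂ ends′-p)) (sym (cong proj₂ ends′-q))
                λ e → t≢-t (signℤ-*-cancel (parity p) (ℤP.neg-injective e)))
        (All.tabulate λ i∈ → subst₂ _≢_ (sym (cong proj₂ ends′-p)) (sym (cong proj₂ (ends′-old i∈)))
                                (InM-new≢ {m} (∣reflected∣ t) (atV∈M i∈)))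
        (All.tabulate λ i∈ → subst₂ _≢_ (sym (cong proj₂ ends′-q)) (sym (cong proj₂ (ends′-old i∈)))
                                (InM-new≢ {m} (∣reflected∣ (- t)) (atV∈M i∈)))
        (λ i∈ j∈ e → atV-injective i∈ j∈
                       (trans (sym (cong proj₂ (ends′-old i∈))) (trans e (cong proj₂ (ends′-old j∈)))))
        where
          t≢-t : t ≢ - t
          t≢-t ()

  record EqualParityPair (xs : List (Fin K)) : Set where
    field
      p q : Fin K
      rest : List (Fin K)
      perm : xs ↭ p ∷ q ∷ rest
      parity≡ : parity p ≡ parity q
      p-multi : single p ≡ false
      q-multi : single q ≡ false

  permute : ∀ {xs ys} → xs ↭ ys → EqualParityPair ys → EqualParityPair xs
  permute xs↭ys P = record
    { p = p ; q = q ; rest = rest ; perm = ↭-trans xs↭ys perm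
    ; parity≡ = parity≡ ; p-multi = p-multi ; q-multi = q-multi }
    where open EqualParityPair P

  equalParityPair₃ : ∀ a b c ys → single a ≡ false → single b ≡ false → single c ≡ false →
                     EqualParityPair (a ∷ b ∷ c ∷ ys)
  equalParityPair₃ a b c ys sa sb sc with parity a SignP.≟ parity b | parity a SignP.≟ parity c
  ... | yes ab | _ = record
    { p = a ; q = b ; rest = c ∷ ys ; perm = ↭-refl ; parity≡ = ab ; p-multi = sa ; q-multi = sb }
  ... | no _ | yes ac = record
    { p = a ; q = c ; rest = b ∷ ys ; perm = ↭-prep a (↭-swap b c ↭-refl)
    ; parity≡ = ac ; p-multi = sa ; q-multi = sc }
  ... | no ab | no ac = record
    { p = b ; q = c ; rest = a ∷ ys ; perm = ↭-sym (shift a (b ∷ c ∷ []) ys)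
    ; parity≡ = sign-pigeonhole _ _ _ ab ac ; p-multi = sb ; q-multi = sc }

  -- at most one of the first four paths is a single edge, and it is moved out of the way
  equalParityPair : ∀ xs → Unique xs → 4 ≤ length xs → EqualParityPair xs
  equalParityPair [] _ ()
  equalParityPair (_ ∷ []) _ (s≤s ())
  equalParityPair (_ ∷ _ ∷ []) _ (s≤s (s≤s ()))
  equalParityPair (_ ∷ _ ∷ _ ∷ []) _ (s≤s (s≤s (s≤s ())))
  equalParityPair (x₁ ∷ x₂ ∷ x₃ ∷ x₄ ∷ rest)
                  ((x₁≢x₂ ∷ x₁≢x₃ ∷ x₁≢x₄ ∷ _) ∷ (x₂≢x₃ ∷ x₂≢x₄ ∷ _) ∷ (x₃≢x₄ ∷ _) ∷ _) _
    with single x₁ in s₁ | single x₂ in s₂ | single x₃ in s₃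
  ... | true | _ | _ =
    permute (↭-sym (shift x₁ (x₂ ∷ x₃ ∷ x₄ ∷ []) rest))
      (equalParityPair₃ x₂ x₃ x₄ (x₁ ∷ rest)
        (single⇒others-not s₁ x₁≢x₂) (single⇒others-not s₁ x₁≢x₃) (single⇒others-not s₁ x₁≢x₄))
  ... | false | true | _ =
    permute (↭-prep x₁ (↭-sym (shift x₂ (x₃ ∷ x₄ ∷ []) rest)))
      (equalParityPair₃ x₁ x₃ x₄ (x₂ ∷ rest) s₁ (single⇒others-not s₂ x₂≢x₃) (single⇒others-not s₂ x₂≢x₄))
  ... | false | false | true =
    permute (↭-prep x₁ (↭-prep x₂ (↭-swap x₃ x₄ ↭-refl)))
      (equalParityPair₃ x₁ x₂ x₄ (x₃ ∷ rest) s₁ s₂ (single⇒others-not s₃ x₃≢x₄))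
  ... | false | false | false = equalParityPair₃ x₁ x₂ x₃ (x₄ ∷ rest) s₁ s₂ s₃

  endColouring : ∀ m xs → Unique xs → length xs ≡ m → 3 ≤ m → EndColouring xs m
  endColouring 1 _ _ _ (s≤s ())
  endColouring 2 _ _ _ (s≤s (s≤s ()))
  endColouring 3 xs u len≡ _ = bySearch xs u len≡ solvableBySearch-3
  endColouring 4 xs u len≡ _ = bySearch xs u len≡ solvableBySearch-4
  endColouring (suc (suc m@(suc (suc (suc _))))) xs u len≡ _ =
    restrict (∈-resp-↭ perm)
      (extend unique′ parity≡ p-multi q-multi (endColouring m rest unique-rest length-rest (s≤s (s≤s (s≤s z≤n)))))
    where
      open EqualParityPair (equalParityPair xs u (subst (4 ≤_) (sym len≡) (s≤s (s≤s (s≤s (s≤s z≤n))))))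
      unique′ : Unique (p ∷ q ∷ rest)
      unique′ = PermutationₛP.Unique-resp-↭ (≡.setoid (Fin K)) (↭⇒↭ₛ perm) u
      unique-rest : Unique rest
      unique-rest with unique′
      ... | _ ∷ _ ∷ u-rest = u-rest
      length-rest : length rest ≡ m
      length-rest = ℕP.suc-injective (ℕP.suc-injective (trans (sym (↭-length perm)) len≡))

-- Colouring a necklace with at least three paths

-- a colour of absolute value 1 that follows c and precedes d on a path
interiorColour : ℤ → ℤ → ℤ
interiorColour c d with c ℤ.≟ -[1+ 0 ] | d ℤ.≟ -[1+ 0 ]
... | no _ | no _ = + 1
... | _ | _ = -[1+ 0 ]

∣interiorColour∣≡1 : ∀ c d → ∣ interiorColour c d ∣ ≡ 1
∣interiorColour∣≡1 c d with c ℤ.≟ -[1+ 0 ] | d ℤ.≟ -[1+ 0 ]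
... | no _ | no _ = refl
... | yes _ | _ = refl
... | no _ | yes _ = refl

interiorColour-fits : ∀ c d → d ≢ - c →
  interiorColour c d ≢ - c × d ≢ - interiorColour c d × interiorColour c d ≢ - interiorColour c d
interiorColour-fits c d d≢-c with c ℤ.≟ -[1+ 0 ] | d ℤ.≟ -[1+ 0 ]
... | yes refl | _ = (λ ()) , d≢-c , (λ ())
... | no _ | yes refl = d≢-c , (λ ()) , (λ ())
... | no c≢-1 | no d≢-1 = (λ e → c≢-1 (trans (sym (ℤP.neg-involutive c)) (cong -_ (sym e)))) , d≢-1 , (λ ())

module Colouring {n : ℕ} {G : Graph n} (N : IndexedNecklace G) (σ′ : Signature G)
                 (3≤k : 3 ≤ IndexedNecklace.k N) where
  open IndexedNecklace N
  open IndexedNecklaceProperties N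

  σ : Fin n → Fin n → Sign
  σ = proj₁ σ′

  -- switching each vertex i j by τ i j makes every edge of path i positive; γ colours the switched path
  τ : Fin k → ℕ → Sign
  τ i zero = ⊕
  τ i (suc j) = σ (vertex i j) (vertex i (suc j)) Sign.* τ i j

  isSingle : Fin k → Bool
  isSingle i = len i ℕ.≡ᵇ 1

  isSingle⇒len≡1 : ∀ {i} → isSingle i ≡ true → len i ≡ 1
  isSingle⇒len≡1 {i} e = ℕP.≡ᵇ⇒≡ (len i) 1 (subst T (sym e) tt)

  len≡1⇒isSingle : ∀ {i} → len i ≡ 1 → isSingle i ≡ true
  len≡1⇒isSingle {i} e = subst (λ l → (l ℕ.≡ᵇ 1) ≡ true) (sym e) refl

  len≢1⇒¬isSingle : ∀ {i} → len i ≢ 1 → isSingle i ≡ false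
  len≢1⇒¬isSingle {i} len≢1 with isSingle i in e
  ... | true = ⊥-elim (len≢1 (isSingle⇒len≡1 e))
  ... | false = refl

  open EndColours (λ i → τ i (len i)) isSingle
                  (λ i j si sj → single-edge-unique i j (isSingle⇒len≡1 si) (isSingle⇒len≡1 sj))
  open EndColouring (endColouring k (allFin k) (UniqueP.allFin⁺ k) (ListP.length-tabulate id) 3≤k)

  -- γ of the last edge of path i, forced by its colour atV i at v
  d : Fin k → ℤ
  d i = - (signℤ (τ i (len i)) ℤ.* atV i)

  single⇒d≡atU : ∀ i → len i ≡ 1 → d i ≡ atU i
  single⇒d≡atU i len≡1 =
    trans (cong (λ b → - (signℤ (τ i (len i)) ℤ.* b)) (proj₁ (compatible (∈-allFin i)) (len≡1⇒isSingle len≡1)))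
          (neg-signℤ-*-involutive (τ i (len i)) (atU i))

  long⇒d≢-atU : ∀ i {j} → suc j < len i → d i ≢ - atU i
  long⇒d≢-atU i j< e = proj₂ (compatible (∈-allFin i)) (len≢1⇒¬isSingle len≢1)
    (trans (sym (signℤ-*-involutive (τ i (len i)) (atV i)))
           (cong (signℤ (τ i (len i)) ℤ.*_) (ℤP.neg-injective e)))
    where
      len≢1 : len i ≢ 1
      len≢1 len≡1 = ℕP.<⇒≢ (ℕP.≤-<-trans (s≤s z≤n) j<) (sym len≡1)

  mid : Fin k → ℤ
  mid i = interiorColour (atU i) (d i)

  γ : Fin k → ℕ → ℤ
  γ i zero = atU i
  γ i (suc j) with suc (suc j) ℕ.≟ len i
  ... | yes _ = d i
  ... | no _ = mid i

  γ-suc-last : ∀ i j → suc (suc j) ≡ len i → γ i (suc j) ≡ d i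
  γ-suc-last i j e with suc (suc j) ℕ.≟ len i
  ... | yes _ = refl
  ... | no ≢len = ⊥-elim (≢len e)

  γ-suc-mid : ∀ i j → suc (suc j) ≢ len i → γ i (suc j) ≡ mid i
  γ-suc-mid i j ≢len with suc (suc j) ℕ.≟ len i
  ... | yes e = ⊥-elim (≢len e)
  ... | no _ = refl

  γ-last : ∀ i j → suc j ≡ len i → γ i j ≡ d i
  γ-last i zero e = sym (single⇒d≡atU i (sym e))
  γ-last i (suc j) e = γ-suc-last i j e

  γ-consecutive : ∀ i j → suc j < len i → γ i (suc j) ≢ - γ i j
  γ-consecutive i zero j< with len i ℕ.≟ 2
  ... | yes e rewrite γ-suc-last i 0 (sym e) = long⇒d≢-atU i j<
  ... | no ≢2 rewrite γ-suc-mid i 0 (≢2 ∘ sym) =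
    proj₁ (interiorColour-fits (atU i) (d i) (long⇒d≢-atU i j<))
  γ-consecutive i (suc j) j< rewrite γ-suc-mid i j (ℕP.<⇒≢ j<) with len i ℕ.≟ suc (suc (suc j))
  ... | yes e rewrite γ-suc-last i (suc j) (sym e) =
    proj₁ (proj₂ (interiorColour-fits (atU i) (d i) (long⇒d≢-atU i j<)))
  ... | no ≢len rewrite γ-suc-mid i (suc j) (≢len ∘ sym) =
    proj₂ (proj₂ (interiorColour-fits (atU i) (d i) (long⇒d≢-atU i j<)))

  γ∈M : ∀ i j → InM k (γ i j)
  γ∈M i zero = atU∈M (∈-allFin i)
  γ∈M i (suc j) with suc (suc j) ℕ.≟ len i
  ... | yes _ = InM-resp-∣∣ {k} (∣-signℤ-*∣ (τ i (len i)) (atV i)) (atV∈M (∈-allFin i))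
  ... | no _ = InM-unit 3≤k (∣interiorColour∣≡1 (atU i) (d i))

  atStart atEnd : Fin k → ℕ → ℤ
  atStart i j = signℤ (τ i j) ℤ.* γ i j
  atEnd i j = - (signℤ (τ i (suc j)) ℤ.* γ i j)

  atStart-0 : ∀ i → atStart i 0 ≡ atU i
  atStart-0 i = ℤP.*-identityˡ (atU i)

  atEnd-last : ∀ i j → suc j ≡ len i → atEnd i j ≡ atV i
  atEnd-last i j e = trans (cong₂ (λ s c → - (signℤ s ℤ.* c)) (cong (τ i) e) (γ-last i j e))
                       (neg-signℤ-*-involutive (τ i (len i)) (atV i))

  atStart≢atEnd-consecutive : ∀ i j → suc j < len i → atStart i (suc j) ≢ atEnd i j
  atStart≢atEnd-consecutive i j j< e =
    γ-consecutive i j j<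
      (signℤ-*-cancel (τ i (suc j)) (trans e (ℤP.neg-distribʳ-* (signℤ (τ i (suc j))) (γ i j))))

  atStart≡-σ-atEnd : ∀ i j → atStart i j ≡ - (signℤ (σ (vertex i j) (vertex i (suc j))) ℤ.* atEnd i j)
  atStart≡-σ-atEnd i j = sym (begin
    - (signℤ s ℤ.* - (signℤ (s Sign.* τ i j) ℤ.* γ i j))
      ≡⟨ cong (λ z → - (signℤ s ℤ.* - (z ℤ.* γ i j))) (signℤ-homo-* s (τ i j)) ⟩
    - (signℤ s ℤ.* - (signℤ s ℤ.* signℤ (τ i j) ℤ.* γ i j))
      ≡⟨ cong (λ z → - (signℤ s ℤ.* - z)) (ℤP.*-assoc (signℤ s) _ _) ⟩
    - (signℤ s ℤ.* - (signℤ s ℤ.* atStart i j))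
      ≡⟨ neg-signℤ-*-involutive s (atStart i j) ⟩
    atStart i j ∎)
    where
      open ≡-Reasoning
      s : Sign
      s = σ (vertex i j) (vertex i (suc j))

  colour : Fin n → Fin n → ℤ
  colour x y with T? (adj G x y)
  ... | no _ = 0ℤ
  ... | yes xy with edge-step x y xy
  ...   | i , j , _ , inj₁ _ = atStart i j
  ...   | i , j , _ , inj₂ _ = atEnd i j

  colour-atStart : ∀ {i j x y} → j < len i → Step vertex i j x y → colour x y ≡ atStart i j
  colour-atStart {i} {j} {x} {y} j< st with T? (adj G x y)
  ... | no ¬xy = ⊥-elim (¬xy (subst₂ (Adj G) (sym (proj₁ st)) (sym (proj₂ st)) (step-adjacent i j<)))
  ... | yes xy with edge-step x y xy
  ...   | _ , _ , j'< , inj₁ st' with step-unique j< j'< st st'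
  ...     | refl , refl = refl
  colour-atStart j< st | yes _ | _ , _ , j'< , inj₂ st' = ⊥-elim (step-not-reversed j< j'< st st')

  colour-atEnd : ∀ {i j x y} → j < len i → Step vertex i j y x → colour x y ≡ atEnd i j
  colour-atEnd {i} {j} {x} {y} j< st with T? (adj G x y)
  ... | no ¬xy = ⊥-elim (¬xy (subst₂ (Adj G) (sym (proj₂ st)) (sym (proj₁ st)) (Adj-sym G (step-adjacent i j<))))
  ... | yes xy with edge-step x y xy
  ...   | _ , _ , j'< , inj₂ st' with step-unique j< j'< st st'
  ...     | refl , refl = refl
  colour-atEnd j< st | yes _ | _ , _ , j'< , inj₁ st' = ⊥-elim (step-not-reversed j'< j< st' st)

  colour∈M : ∀ x y → Adj G x y → InM k (colour x y)
  colour∈M x y xy with edge-step x y xy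
  ... | i , j , j< , inj₁ st =
    subst (InM k) (sym (colour-atStart j< st)) (InM-resp-∣∣ {k} (∣signℤ-*∣ (τ i j) (γ i j)) (γ∈M i j))
  ... | i , j , j< , inj₂ st =
    subst (InM k) (sym (colour-atEnd j< st)) (InM-resp-∣∣ {k} (∣-signℤ-*∣ (τ i (suc j)) (γ i j)) (γ∈M i j))

  colour-antisymmetric : ∀ x y → Adj G x y → colour x y ≡ - (signℤ (σ x y) ℤ.* colour y x)
  colour-antisymmetric x y xy with edge-step x y xy
  ... | i , j , j< , inj₁ (refl , refl) =
    trans (colour-atStart j< (refl , refl))
          (trans (atStart≡-σ-atEnd i j)
                 (cong (λ c → - (signℤ (σ x y) ℤ.* c)) (sym (colour-atEnd j< (refl , refl)))))
  ... | i , j , j< , inj₂ (refl , refl) = begin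
    colour x y
      ≡⟨ colour-atEnd j< (refl , refl) ⟩
    atEnd i j
      ≡⟨ neg-signℤ-*-involutive (σ y x) (atEnd i j) ⟨
    - (signℤ (σ y x) ℤ.* - (signℤ (σ y x) ℤ.* atEnd i j))
      ≡⟨ cong (λ c → - (signℤ (σ y x) ℤ.* c)) (atStart≡-σ-atEnd i j) ⟨
    - (signℤ (σ y x) ℤ.* atStart i j)
      ≡⟨ cong₂ (λ s c → - (signℤ s ℤ.* c)) (proj₂ σ′ x y xy) (colour-atStart j< (refl , refl)) ⟨
    - (signℤ (σ x y) ℤ.* colour y x) ∎
    where open ≡-Reasoning

  atStart-separates : ∀ {i i' j j'} → j < len i → j' < len i' → vertex i j ≡ vertex i' j' →
                      atStart i j ≡ atStart i' j' → i ≡ i' × j ≡ j'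
  atStart-separates {i} {i'} j< j'< e e' with vertex-coincidence i i' (ℕP.<⇒≤ j<) (ℕP.<⇒≤ j'<) e
  ... | inj₁ same = same
  ... | inj₂ (inj₁ (refl , refl)) =
    atU-injective (∈-allFin i) (∈-allFin i') (trans (sym (atStart-0 i)) (trans e' (atStart-0 i'))) , refl
  ... | inj₂ (inj₂ (refl , _)) = ⊥-elim (ℕP.<-irrefl refl j<)

  atEnd-separates : ∀ {i i' j j'} → j < len i → j' < len i' → vertex i (suc j) ≡ vertex i' (suc j') →
                    atEnd i j ≡ atEnd i' j' → i ≡ i' × j ≡ j'
  atEnd-separates {i} {i'} {j} {j'} j< j'< e e' with vertex-coincidence i i' j< j'< e
  ... | inj₁ (i≡i' , 1+j≡1+j') = i≡i' , ℕP.suc-injective 1+j≡1+j'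
  ... | inj₂ (inj₂ (last , last')) with atV-injective (∈-allFin i) (∈-allFin i')
                                          (trans (sym (atEnd-last i j last)) (trans e' (atEnd-last i' j' last')))
  ...   | refl = refl , ℕP.suc-injective (trans last (sym last'))

  atStart≢atEnd : ∀ {i i' j j'} → j < len i → j' < len i' → vertex i j ≡ vertex i' (suc j') →
                  atStart i j ≢ atEnd i' j'
  atStart≢atEnd {i} {i'} {j} {j'} j< j'< e with vertex-coincidence i i' (ℕP.<⇒≤ j<) j'< e
  ... | inj₁ (refl , refl) = atStart≢atEnd-consecutive i j' j<
  ... | inj₂ (inj₂ (refl , _)) = ⊥-elim (ℕP.<-irrefl refl j<)

  colour-proper : ∀ x y w → Adj G x y → Adj G x w → y ≢ w → colour x y ≢ colour x w
  colour-proper x y w xy xw y≢w e with edge-step x y xy | edge-step x w xw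
  ... | _ , _ , j< , inj₁ (x≡ , y≡) | _ , _ , j'< , inj₁ (x≡' , w≡)
    with atStart-separates j< j'< (trans (sym x≡) x≡')
           (trans (sym (colour-atStart j< (x≡ , y≡))) (trans e (colour-atStart j'< (x≡' , w≡))))
  ...   | refl , refl = y≢w (trans y≡ (sym w≡))
  colour-proper x y w xy xw y≢w e | _ , _ , j< , inj₂ (y≡ , x≡) | _ , _ , j'< , inj₂ (w≡ , x≡')
    with atEnd-separates j< j'< (trans (sym x≡) x≡')
           (trans (sym (colour-atEnd j< (y≡ , x≡))) (trans e (colour-atEnd j'< (w≡ , x≡'))))
  ...   | refl , refl = y≢w (trans y≡ (sym w≡))
  colour-proper x y w xy xw y≢w e | _ , _ , j< , inj₁ (x≡ , y≡) | _ , _ , j'< , inj₂ (w≡ , x≡') =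
    atStart≢atEnd j< j'< (trans (sym x≡) x≡')
      (trans (sym (colour-atStart j< (x≡ , y≡))) (trans e (colour-atEnd j'< (w≡ , x≡'))))
  colour-proper x y w xy xw y≢w e | _ , _ , j< , inj₂ (y≡ , x≡) | _ , _ , j'< , inj₁ (x≡' , w≡) =
    atStart≢atEnd j'< j< (trans (sym x≡') x≡)
      (trans (sym (colour-atStart j'< (x≡' , w≡))) (trans (sym e) (colour-atEnd j< (y≡ , x≡))))

  colouring : EdgeColoring G σ′ k
  colouring = colour , colour∈M , colour-antisymmetric , colour-proper

theorem6 : ∀ (n : ℕ) (G : Graph n) → IsNecklace G → ¬ IsCycle G → Class1± G
theorem6 n G necklace notCycle σ =
  subst (ChromaticIndexIs G σ) (sym Δ≡k)
    (ℕP.≤-trans (s≤s z≤n) 3≤k , Colouring.colouring N σ 3≤k , λ m _ m<k χ → ℕP.<⇒≱ m<k (k≤colours {σ} χ))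
  where
    N : IndexedNecklace G
    N = indexNecklace necklace
    open IndexedNecklace N
    open Degrees N
    3≤k : 3 ≤ k
    3≤k with k ℕ.≟ 2
    ... | yes k≡2 = ⊥-elim (notCycle (twoPaths⇒cycle N k≡2))
    ... | no k≢2 = ℕP.≤∧≢⇒< 2≤k (k≢2 ∘ sym)
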